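{- Let $C\subseteq\mathbb{F}_2^n$ be a binary linear code of length $n$ and $g\ge1$. If the punctured code $C-i$ is the same for every coordinate $i\in[n]$, then for every $i\in[n]$, \[W^{(g)}_{C-i}=\frac{1}{n}\sum_{a\in\mathbb{F}_2^g}\frac{\partial}{\partial x_a}W^{(g)}_C.\]
   Context: $[n]=\{1,\dots,n\}$. $C-i$ denotes the punctured code, regarded as the collection (with multiplicity) of vectors of length $n-1$ obtained from all $u\in C$ by deleting coordinate $i$. For vectors $w_1,\dots,w_g$ of a common length and $b\in\mathbb{F}_2^g$, $n_b(w_1,\dots,w_g)$ is the number of positions $j$ with $(w_{1j},\dots,w_{gj})=b$. For a collection $D$ of vectors of a common length, the genus-$g$ weight enumerator is $W^{(g)}_D=\sum_{w_1,\dots,w_g\in D}\prod_{b\in\mathbb{F}_2^g}x_b^{n_b(w_1,\dots,w_g)}$, a polynomial in the $2^g$ variables $\{x_b\}_{b\in\mathbb{F}_2^g}$. -}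

module Defs where

open import Data.Bool using (Bool; true; false; _xor_; if_then_else_)
open import Data.Nat using (ℕ; zero; suc; pred; _+_; _*_)
open import Data.Fin using (Fin; zero; suc)
open import Data.Vec using (Vec; []; _∷_; lookup; replicate; zipWith)
import Data.Vec as V
open import Data.Vec.Properties using (≡-dec)
import Data.Bool.Properties as BP
open import Data.List using (List; []; _∷_; [_]; map; concatMap; filter; length; _++_)
open import Data.List.Relation.Unary.All using (All; all?)
open import Relation.Nullary using (Dec; yes; no; does)
open import Relation.Binary.PropositionalEquality using (_≡_)
open import Data.Product using (_×_)
open import Data.Nat.ListAction using (sum)

-- F₂ is modelled by Bool (false = 0, true = 1, addition = xor).
F2^ : ℕ → Set
F2^ n = Vec Bool n

_≟v_ : ∀ {n} → (u v : F2^ n) → Dec (u ≡ v)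
_≟v_ = ≡-dec BP._≟_

allVecs : (n : ℕ) → List (F2^ n)
allVecs zero = [ [] ]
allVecs (suc n) = map (false ∷_) (allVecs n) ++ map (true ∷_) (allVecs n)

allPos : (n : ℕ) → List (Fin n)
allPos zero = []
allPos (suc n) = zero ∷ map suc (allPos n)

Code : ℕ → Set
Code n = F2^ n → Bool

IsLinear : ∀ {n} → Code n → Set
IsLinear {n} C = (C (replicate n false) ≡ true)
  × (∀ u v → C u ≡ true → C v ≡ true → C (zipWith _xor_ u v) ≡ true)


elements : ∀ {n} → Code n → List (F2^ n)
elements {n} C = filter (λ u → C u BP.≟ true) (allVecs n)

puncture : ∀ {A : Set} {n} → Vec A n → Fin n → Vec A (pred n)
puncture (x ∷ xs) zero = xs
puncture (x ∷ y ∷ xs) (suc i) = x ∷ puncture (y ∷ xs) i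

-- the punctured code C - i, as a collection with multiplicity
punctured : ∀ {n} → Code n → Fin n → List (F2^ (pred n))
punctured C i = map (λ u → puncture u i) (elements C)

tuples : ∀ {A : Set} → List A → (g : ℕ) → List (Vec A g)
tuples D zero = [ [] ]
tuples D (suc g) = concatMap (λ w → map (w ∷_) (tuples D g)) D

nb : ∀ {m g} → Vec (F2^ m) g → F2^ g → ℕ
nb {m} ws b = length (filter (λ j → V.map (λ w → lookup w j) ws ≟v b) (allPos m))

-- exponent vectors of monomials in the 2^g variables x_b, b ∈ F₂^g
Exponent : ℕ → Set
Exponent g = F2^ g → ℕ

-- Polynomials with ℕ coefficients in the variables {x_b}, represented by
-- their coefficient function.
Poly : ℕ → Set
Poly g = Exponent g → ℕ

-- genus-g weight enumerator W^(g)_D : coefficient of ∏_b x_b^{e b}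
-- is the number of tuples in D^g whose monomial ∏_b x_b^{n_b} equals it.
W : ∀ {m} (g : ℕ) → List (F2^ m) → Poly g
W g D e = length (filter (λ ws → all? (λ b → nb ws b Data.Nat.≟ e b) (allVecs g)) (tuples D g))
  where import Data.Nat

bump : ∀ {g} → F2^ g → Exponent g → Exponent g
bump a e b with b ≟v a
... | yes _ = suc (e b)
... | no _ = e b

∂ : ∀ {g} → F2^ g → Poly g → Poly g
∂ a P e = suc (e a) * P (bump a e)

ΣPoly : ∀ {g} → (F2^ g → Poly g) → Poly g
ΣPoly {g} F e = sum (map (λ a → F a e) (allVecs g))

_·_ : ∀ {g} → ℕ → Poly g → Poly g
(k · P) e = k * P e

{-# OPTIONS --safe #-}
-- Deleting coordinate j from a g-tuple ws of codewords removes one occurrence of its j-th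
-- column a = (w₁ⱼ,…,w_gⱼ), so the monomial of the punctured tuple is x^e exactly when the
-- monomial of ws is x^e·x_a. Summing over the n positions and grouping them by column, the
-- n_a(ws) positions with column a contribute n_a(ws) = e_a + 1 each, which is the coefficient
-- of x^e in ∂/∂x_a of the monomial of ws. Hence ∑_j W_{C-j} = ∑_a ∂W_C/∂x_a for every code C;
-- when all punctured codes agree, the left side is n·W_{C-i}.
module Submission where

open import Defs
open import Data.Nat using (ℕ; _≤_; pred)
open import Data.Fin using (Fin)
open import Data.List.Relation.Binary.Permutation.Propositional using (_↭_)
open import Relation.Binary.PropositionalEquality using (_≡_)

open import Data.Bool using (true; false; if_then_else_)
open import Data.Nat using (zero; suc; _+_; _*_)
import Data.Nat as ℕ
open import Data.Nat.Properties
  using (+-assoc; +-identityʳ; +-cancelˡ-≡; *-zeroʳ; *-distribˡ-+; *-distribʳ-+; +-commutativeSemigroup)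
open import Algebra.Properties.CommutativeSemigroup +-commutativeSemigroup using (interchange; x∙yz≈y∙xz)
open import Data.Fin using (zero; suc; punchIn)
open import Data.Vec using (Vec; []; _∷_; lookup)
import Data.Vec as V
open import Data.List using (List; []; _∷_; map; concatMap; filter; length; _++_)
open import Data.List.Membership.Propositional using (_∈_)
open import Data.List.Membership.Propositional.Properties using (∈-++⁺ˡ; ∈-++⁺ʳ; ∈-map⁺)
open import Data.List.Relation.Unary.All as All using (All; all?)
open import Data.List.Relation.Unary.Any using (here)
open import Data.List.Relation.Binary.Permutation.Propositional.Properties using (map⁺)
open import Data.Nat.ListAction using (sum)
open import Data.Nat.ListAction.Properties using (sum-↭)
open import Relation.Nullary using (Dec; yes; no; does)
open import Relation.Nullary.Decidable using (does-⇔)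
open import Function.Bundles using (mk⇔)
open import Relation.Binary.PropositionalEquality using (refl; sym; trans; cong; cong₂; module ≡-Reasoning)
open import Data.Empty using (⊥-elim)

private
  variable
    A B : Set

∑ : List A → (A → ℕ) → ℕ
∑ xs f = sum (map f xs)

syntax ∑ xs (λ x → f) = ∑[ x ← xs ] f

∑-cong : (xs : List A) {f h : A → ℕ} → (∀ x → f x ≡ h x) → ∑ xs f ≡ ∑ xs h
∑-cong []       eq = refl
∑-cong (x ∷ xs) eq = cong₂ _+_ (eq x) (∑-cong xs eq)

∑-zero : (xs : List A) {f : A → ℕ} → (∀ x → f x ≡ 0) → ∑ xs f ≡ 0
∑-zero []       eq = refl
∑-zero (x ∷ xs) eq = cong₂ _+_ (eq x) (∑-zero xs eq)

∑-++ : (xs ys : List A) (f : A → ℕ) → ∑ (xs ++ ys) f ≡ ∑ xs f + ∑ ys f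
∑-++ []       ys f = refl
∑-++ (x ∷ xs) ys f = trans (cong (f x +_) (∑-++ xs ys f)) (sym (+-assoc (f x) _ _))

∑-distrib-+ : (xs : List A) (f h : A → ℕ) → ∑[ x ← xs ] (f x + h x) ≡ ∑ xs f + ∑ xs h
∑-distrib-+ []       f h = refl
∑-distrib-+ (x ∷ xs) f h =
  trans (cong (f x + h x +_) (∑-distrib-+ xs f h)) (interchange (f x) (h x) (∑ xs f) (∑ xs h))

∑-*ˡ : (xs : List A) (k : ℕ) (f : A → ℕ) → ∑[ x ← xs ] (k * f x) ≡ k * ∑ xs f
∑-*ˡ []       k f = sym (*-zeroʳ k)
∑-*ˡ (x ∷ xs) k f = trans (cong (k * f x +_) (∑-*ˡ xs k f)) (sym (*-distribˡ-+ k (f x) (∑ xs f)))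

∑-*ʳ : (xs : List A) (f : A → ℕ) (k : ℕ) → ∑[ x ← xs ] (f x * k) ≡ ∑ xs f * k
∑-*ʳ []       f k = refl
∑-*ʳ (x ∷ xs) f k = trans (cong (f x * k +_) (∑-*ʳ xs f k)) (sym (*-distribʳ-+ k (f x) (∑ xs f)))

∑-comm : (xs : List A) (ys : List B) (f : A → B → ℕ)
  → ∑[ x ← xs ] ∑[ y ← ys ] f x y ≡ ∑[ y ← ys ] ∑[ x ← xs ] f x y
∑-comm []       ys f = sym (∑-zero ys (λ _ → refl))
∑-comm (x ∷ xs) ys f =
  trans (cong (∑ ys (f x) +_) (∑-comm xs ys f))
        (sym (∑-distrib-+ ys (f x) (λ y → ∑[ x′ ← xs ] f x′ y)))

∑-↭ : {xs ys : List A} (f : A → ℕ) → xs ↭ ys → ∑ xs f ≡ ∑ ys f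
∑-↭ f p = sum-↭ (map⁺ f p)

∑-map : (g : A → B) (xs : List A) (f : B → ℕ) → ∑ (map g xs) f ≡ ∑[ x ← xs ] f (g x)
∑-map g []       f = refl
∑-map g (x ∷ xs) f = cong (f (g x) +_) (∑-map g xs f)

∑-concatMap : (h : A → List B) (xs : List A) (f : B → ℕ)
  → ∑ (concatMap h xs) f ≡ ∑[ x ← xs ] ∑ (h x) f
∑-concatMap h []       f = refl
∑-concatMap h (x ∷ xs) f =
  trans (∑-++ (h x) (concatMap h xs) f) (cong (∑ (h x) f +_) (∑-concatMap h xs f))

indicator : ∀ {P : Set} → Dec P → ℕ
indicator P? = if does P? then 1 else 0

length-filter : ∀ {P : A → Set} (P? : ∀ x → Dec (P x)) (xs : List A)
  → length (filter P? xs) ≡ ∑[ x ← xs ] indicator (P? x)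
length-filter P? []       = refl
length-filter P? (x ∷ xs) with does (P? x)
... | true  = cong suc (length-filter P? xs)
... | false = length-filter P? xs

∈-allVecs : ∀ g (a : F2^ g) → a ∈ allVecs g
∈-allVecs zero    []          = here refl
∈-allVecs (suc g) (false ∷ a) = ∈-++⁺ˡ (∈-map⁺ (false ∷_) (∈-allVecs g a))
∈-allVecs (suc g) (true ∷ a)  =
  ∈-++⁺ʳ (map (false ∷_) (allVecs g)) (∈-map⁺ (true ∷_) (∈-allVecs g a))

∑-allVecs-suc : ∀ g (f : F2^ (suc g) → ℕ)
  → ∑ (allVecs (suc g)) f ≡ ∑[ a ← allVecs g ] f (false ∷ a) + ∑[ a ← allVecs g ] f (true ∷ a)
∑-allVecs-suc g f = trans (∑-++ (map (false ∷_) (allVecs g)) _ f)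
  (cong₂ _+_ (∑-map (false ∷_) (allVecs g) f) (∑-map (true ∷_) (allVecs g) f))

δ : ∀ {g} → F2^ g → F2^ g → ℕ
δ x b = indicator (x ≟v b)

∑-δ-select : ∀ g (x : F2^ g) (h : F2^ g → ℕ) → ∑[ a ← allVecs g ] (δ x a * h a) ≡ h x
∑-δ-select zero    []          h = trans (+-identityʳ _) (+-identityʳ _)
∑-δ-select (suc g) (false ∷ x) h = trans (∑-allVecs-suc g _)
  (trans (cong₂ _+_ (∑-δ-select g x (λ a → h (false ∷ a))) (∑-zero (allVecs g) (λ _ → refl)))
         (+-identityʳ _))
∑-δ-select (suc g) (true ∷ x)  h = trans (∑-allVecs-suc g _)
  (cong₂ _+_ (∑-zero (allVecs g) (λ _ → refl)) (∑-δ-select g x (λ a → h (true ∷ a))))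

∑-allPos-const : ∀ n (c : ℕ) → ∑[ j ← allPos n ] c ≡ n * c
∑-allPos-const zero    c = refl
∑-allPos-const (suc n) c = cong (c +_) (trans (∑-map suc (allPos n) _) (∑-allPos-const n c))

∑-allPos-punchIn : ∀ m (f : Fin (suc m) → ℕ) (j : Fin (suc m))
  → ∑ (allPos (suc m)) f ≡ f j + ∑[ k ← allPos m ] f (punchIn j k)
∑-allPos-punchIn m       f zero    = cong (f zero +_) (∑-map suc (allPos m) f)
∑-allPos-punchIn (suc m) f (suc j) = begin
  f zero + ∑ (map suc (allPos (suc m))) f
    ≡⟨ cong (f zero +_) (trans (∑-map suc (allPos (suc m)) f) (∑-allPos-punchIn m (λ k → f (suc k)) j)) ⟩
  f zero + (f (suc j) + ∑[ k ← allPos m ] f (suc (punchIn j k)))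
    ≡⟨ x∙yz≈y∙xz (f zero) (f (suc j)) _ ⟩
  f (suc j) + (f zero + ∑[ k ← allPos m ] f (suc (punchIn j k)))
    ≡⟨ cong (λ s → f (suc j) + (f zero + s)) (sym (∑-map suc (allPos m) (λ k → f (punchIn (suc j) k)))) ⟩
  f (suc j) + ∑[ k ← allPos (suc m) ] f (punchIn (suc j) k) ∎
  where open ≡-Reasoning

∑-tuples-suc : ∀ (D : List A) g (h : Vec A (suc g) → ℕ)
  → ∑ (tuples D (suc g)) h ≡ ∑[ w ← D ] ∑[ ws ← tuples D g ] h (w ∷ ws)
∑-tuples-suc D g h = trans (∑-concatMap _ D h) (∑-cong D (λ w → ∑-map (w ∷_) (tuples D g) h))

∑-tuples-map : ∀ (f : A → B) (D : List A) g (h : Vec B g → ℕ)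
  → ∑ (tuples (map f D) g) h ≡ ∑[ ws ← tuples D g ] h (V.map f ws)
∑-tuples-map f D zero    h = refl
∑-tuples-map f D (suc g) h = begin
  ∑ (tuples (map f D) (suc g)) h
    ≡⟨ trans (∑-tuples-suc (map f D) g h) (∑-map f D _) ⟩
  ∑[ w ← D ] ∑[ ws ← tuples (map f D) g ] h (f w ∷ ws)
    ≡⟨ ∑-cong D (λ w → ∑-tuples-map f D g (λ ws → h (f w ∷ ws))) ⟩
  ∑[ w ← D ] ∑[ ws ← tuples D g ] h (f w ∷ V.map f ws)
    ≡⟨ sym (∑-tuples-suc D g _) ⟩
  ∑[ ws ← tuples D (suc g) ] h (V.map f ws) ∎
  where open ≡-Reasoning

∑-tuples-↭ : ∀ {D D′ : List A} → D ↭ D′ → ∀ g (h : Vec A g → ℕ)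
  → ∑ (tuples D g) h ≡ ∑ (tuples D′ g) h
∑-tuples-↭ p zero    h = refl
∑-tuples-↭ {D = D} {D′} p (suc g) h = begin
  ∑ (tuples D (suc g)) h
    ≡⟨ ∑-tuples-suc D g h ⟩
  ∑[ w ← D ] ∑[ ws ← tuples D g ] h (w ∷ ws)
    ≡⟨ ∑-cong D (λ w → ∑-tuples-↭ p g (λ ws → h (w ∷ ws))) ⟩
  ∑[ w ← D ] ∑[ ws ← tuples D′ g ] h (w ∷ ws)
    ≡⟨ ∑-↭ _ p ⟩
  ∑[ w ← D′ ] ∑[ ws ← tuples D′ g ] h (w ∷ ws)
    ≡⟨ sym (∑-tuples-suc D′ g h) ⟩
  ∑ (tuples D′ (suc g)) h ∎
  where open ≡-Reasoning

column : ∀ {m g} → Vec (F2^ m) g → Fin m → F2^ g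
column ws j = V.map (λ w → lookup w j) ws

punctureAll : ∀ {m g} → Vec (F2^ (suc m)) g → Fin (suc m) → Vec (F2^ m) g
punctureAll ws j = V.map (λ w → puncture w j) ws

lookup-puncture : ∀ {m} (w : Vec A (suc m)) (j : Fin (suc m)) (k : Fin m)
  → lookup (puncture w j) k ≡ lookup w (punchIn j k)
lookup-puncture (x ∷ xs)     zero    k       = refl
lookup-puncture (x ∷ y ∷ xs) (suc j) zero    = refl
lookup-puncture (x ∷ y ∷ xs) (suc j) (suc k) = lookup-puncture (y ∷ xs) j k

column-punctureAll : ∀ {m g} (ws : Vec (F2^ (suc m)) g) (j : Fin (suc m)) (k : Fin m)
  → column (punctureAll ws j) k ≡ column ws (punchIn j k)
column-punctureAll []       j k = refl
column-punctureAll (w ∷ ws) j k = cong₂ _∷_ (lookup-puncture w j k) (column-punctureAll ws j k)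

nb-∑ : ∀ {m g} (ws : Vec (F2^ m) g) (b : F2^ g) → nb ws b ≡ ∑[ j ← allPos m ] δ (column ws j) b
nb-∑ {m} ws b = length-filter (λ j → column ws j ≟v b) (allPos m)

nb-punctureAll : ∀ {m g} (ws : Vec (F2^ (suc m)) g) (j : Fin (suc m)) (b : F2^ g)
  → nb ws b ≡ δ (column ws j) b + nb (punctureAll ws j) b
nb-punctureAll {m} ws j b = begin
  nb ws b
    ≡⟨ nb-∑ ws b ⟩
  ∑[ k ← allPos (suc m) ] δ (column ws k) b
    ≡⟨ ∑-allPos-punchIn m _ j ⟩
  δ a b + ∑[ k ← allPos m ] δ (column ws (punchIn j k)) b
    ≡⟨ cong (δ a b +_) (∑-cong (allPos m) (λ k → cong (λ c → δ c b) (sym (column-punctureAll ws j k)))) ⟩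
  δ a b + ∑[ k ← allPos m ] δ (column (punctureAll ws j) k) b
    ≡⟨ cong (δ a b +_) (sym (nb-∑ (punctureAll ws j) b)) ⟩
  δ a b + nb (punctureAll ws j) b ∎
  where
  open ≡-Reasoning
  a = column ws j

∑-column : ∀ {m g} (ws : Vec (F2^ m) g) (h : F2^ g → ℕ)
  → ∑[ j ← allPos m ] h (column ws j) ≡ ∑[ a ← allVecs g ] (nb ws a * h a)
∑-column {m} {g} ws h = begin
  ∑[ j ← allPos m ] h (column ws j)
    ≡⟨ ∑-cong (allPos m) (λ j → sym (∑-δ-select g (column ws j) h)) ⟩
  ∑[ j ← allPos m ] ∑[ a ← allVecs g ] (δ (column ws j) a * h a)
    ≡⟨ ∑-comm (allPos m) (allVecs g) _ ⟩
  ∑[ a ← allVecs g ] ∑[ j ← allPos m ] (δ (column ws j) a * h a)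
    ≡⟨ ∑-cong (allVecs g) (λ a → ∑-*ʳ (allPos m) _ (h a)) ⟩
  ∑[ a ← allVecs g ] (∑[ j ← allPos m ] δ (column ws j) a * h a)
    ≡⟨ ∑-cong (allVecs g) (λ a → cong (_* h a) (sym (nb-∑ ws a))) ⟩
  ∑[ a ← allVecs g ] (nb ws a * h a) ∎
  where open ≡-Reasoning

bump-δ : ∀ {g} (a : F2^ g) (e : Exponent g) (b : F2^ g) → bump a e b ≡ δ a b + e b
bump-δ a e b with b ≟v a | a ≟v b
... | yes _   | yes _   = refl
... | no _    | no _    = refl
... | yes b≡a | no a≢b  = ⊥-elim (a≢b (sym b≡a))
... | no b≢a  | yes a≡b = ⊥-elim (b≢a (sym a≡b))

bump-self : ∀ {g} (a : F2^ g) (e : Exponent g) → bump a e a ≡ suc (e a)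
bump-self a e with a ≟v a
... | yes _  = refl
... | no a≢a = ⊥-elim (a≢a refl)

monomial : ∀ {m g} → Vec (F2^ m) g → Poly g
monomial {g = g} ws e = indicator (all? (λ b → nb ws b ℕ.≟ e b) (allVecs g))

W-∑-monomial : ∀ {m} g (D : List (F2^ m)) (e : Exponent g)
  → W g D e ≡ ∑[ ws ← tuples D g ] monomial ws e
W-∑-monomial g D e = length-filter _ (tuples D g)

W-↭ : ∀ {m} g {D D′ : List (F2^ m)} → D ↭ D′ → (e : Exponent g) → W g D e ≡ W g D′ e
W-↭ g {D} {D′} p e =
  trans (W-∑-monomial g D e) (trans (∑-tuples-↭ p g _) (sym (W-∑-monomial g D′ e)))

monomial-punctureAll : ∀ {m g} (ws : Vec (F2^ (suc m)) g) (j : Fin (suc m)) (e : Exponent g)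
  → monomial (punctureAll ws j) e ≡ monomial ws (bump (column ws j) e)
monomial-punctureAll {g = g} ws j e =
  cong (λ t → if t then 1 else 0) (does-⇔ (mk⇔ (All.map to) (All.map from))
             (all? (λ b → nb (punctureAll ws j) b ℕ.≟ e b) (allVecs g))
             (all? (λ b → nb ws b ℕ.≟ bump a e b) (allVecs g)))
  where
  a = column ws j
  to : ∀ {b} → nb (punctureAll ws j) b ≡ e b → nb ws b ≡ bump a e b
  to {b} eq = trans (nb-punctureAll ws j b) (trans (cong (δ a b +_) eq) (sym (bump-δ a e b)))
  from : ∀ {b} → nb ws b ≡ bump a e b → nb (punctureAll ws j) b ≡ e b
  from {b} eq = +-cancelˡ-≡ (δ a b) _ _ (trans (sym (nb-punctureAll ws j b)) (trans eq (bump-δ a e b)))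

nb*monomial-bump : ∀ {m g} (ws : Vec (F2^ m) g) (a : F2^ g) (e : Exponent g)
  → nb ws a * monomial ws (bump a e) ≡ suc (e a) * monomial ws (bump a e)
nb*monomial-bump {g = g} ws a e with all? (λ b → nb ws b ℕ.≟ bump a e b) (allVecs g)
... | yes nb≡bump = cong (_* 1) (trans (All.lookup nb≡bump (∈-allVecs g a)) (bump-self a e))
... | no _        = trans (*-zeroʳ (nb ws a)) (sym (*-zeroʳ (suc (e a))))

∑-monomial-punctureAll : ∀ {m g} (ws : Vec (F2^ (suc m)) g) (e : Exponent g)
  → ∑[ j ← allPos (suc m) ] monomial (punctureAll ws j) e ≡ ΣPoly (λ a → ∂ a (monomial ws)) e
∑-monomial-punctureAll {m} {g} ws e = begin
  ∑[ j ← allPos (suc m) ] monomial (punctureAll ws j) e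
    ≡⟨ ∑-cong (allPos (suc m)) (λ j → monomial-punctureAll ws j e) ⟩
  ∑[ j ← allPos (suc m) ] monomial ws (bump (column ws j) e)
    ≡⟨ ∑-column ws (λ a → monomial ws (bump a e)) ⟩
  ∑[ a ← allVecs g ] (nb ws a * monomial ws (bump a e))
    ≡⟨ ∑-cong (allVecs g) (λ a → nb*monomial-bump ws a e) ⟩
  ∑[ a ← allVecs g ] (suc (e a) * monomial ws (bump a e)) ∎
  where open ≡-Reasoning

∑-W-puncture : ∀ {m} g (D : List (F2^ (suc m))) (e : Exponent g)
  → ∑[ j ← allPos (suc m) ] W g (map (λ u → puncture u j) D) e ≡ ΣPoly (λ a → ∂ a (W g D)) e
∑-W-puncture {m} g D e = begin
  ∑[ j ← allPos (suc m) ] W g (map (λ u → puncture u j) D) e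
    ≡⟨ ∑-cong (allPos (suc m)) (λ j →
         trans (W-∑-monomial g _ e) (∑-tuples-map _ D g (λ ws → monomial ws e))) ⟩
  ∑[ j ← allPos (suc m) ] ∑[ ws ← tuples D g ] monomial (punctureAll ws j) e
    ≡⟨ ∑-comm (allPos (suc m)) (tuples D g) _ ⟩
  ∑[ ws ← tuples D g ] ∑[ j ← allPos (suc m) ] monomial (punctureAll ws j) e
    ≡⟨ ∑-cong (tuples D g) (λ ws → ∑-monomial-punctureAll ws e) ⟩
  ∑[ ws ← tuples D g ] ∑[ a ← allVecs g ] (suc (e a) * monomial ws (bump a e))
    ≡⟨ ∑-comm (tuples D g) (allVecs g) _ ⟩
  ∑[ a ← allVecs g ] ∑[ ws ← tuples D g ] (suc (e a) * monomial ws (bump a e))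
    ≡⟨ ∑-cong (allVecs g) (λ a → trans (∑-*ˡ (tuples D g) (suc (e a)) _)
                                       (cong (suc (e a) *_) (sym (W-∑-monomial g D (bump a e))))) ⟩
  ∑[ a ← allVecs g ] (suc (e a) * W g D (bump a e)) ∎
  where open ≡-Reasoning

lemma3p6 : (n g : ℕ) → 1 ≤ g → (C : Code n) → IsLinear C
    → (∀ (i j : Fin n) → punctured C i ↭ punctured C j)
    → ∀ (i : Fin n) (e : Exponent g)
    → (n · W g (punctured C i)) e ≡ ΣPoly (λ a → ∂ a (W g (elements C))) e
lemma3p6 zero    g _ C _ _         () e
lemma3p6 (suc m) g _ C _ C-i↭C-j i  e = begin
  suc m * W g (punctured C i) e
    ≡⟨ sym (∑-allPos-const (suc m) _) ⟩
  ∑[ j ← allPos (suc m) ] W g (punctured C i) e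
    ≡⟨ ∑-cong (allPos (suc m)) (λ j → W-↭ g (C-i↭C-j i j) e) ⟩
  ∑[ j ← allPos (suc m) ] W g (punctured C j) e
    ≡⟨ ∑-W-puncture g (elements C) e ⟩
  ΣPoly (λ a → ∂ a (W g (elements C))) e ∎
  where open ≡-Reasoning
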